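{- The translation $[\![\cdot]\!]_{\lambda}$ of SF-terms into $\lambda$-terms preserves reduction and strong normalisation: for all SF-terms $M, N$, if $M \rightarrow_{\mathrm{SF}}^{\ast} N$ then $[\![M]\!]_{\lambda} \rightarrow_{\beta}^{\ast} [\![N]\!]_{\lambda}$; and if $M$ is strongly normalising with respect to $\rightarrow_{\mathrm{SF}}$ then $[\![M]\!]_{\lambda}$ is strongly normalising with respect to $\beta$-reduction.
   Context: SF-calculus: terms are given by $M, N ::= \mathbf{S} \mid \mathbf{F} \mid M\,N$ (application, left-associative; no variables). Terms of the form $\mathbf{S}$, $\mathbf{F}$, $\mathbf{S}\,M$, $\mathbf{F}\,M$, $\mathbf{S}\,M\,N$, $\mathbf{F}\,M\,N$ are called factorable forms. The one-step reduction $\rightarrow_{\mathrm{SF}}$ is the smallest relation closed under term contexts satisfying: $\mathbf{S}\,M\,N\,X \rightarrow_{\mathrm{SF}} M\,X\,(N\,X)$; $\mathbf{F}\,O\,M\,N \rightarrow_{\mathrm{SF}} M$ if $O$ is $\mathbf{S}$ or $\mathbf{F}$; $\mathbf{F}\,(P\,Q)\,M\,N \rightarrow_{\mathrm{SF}} N\,P\,Q$ if $P\,Q$ is a factorable form; $\rightarrow_{\mathrm{SF}}^{\ast}$ is its reflexive transitive closure. Curryfied applicative SF-calculus: the set $\mathcal{E}$ of first-order rewrite rules over the signature with constructors $\mathbf{S}_0,\mathbf{F}_0$ (arity 0), $\mathbf{S}_1,\mathbf{F}_1$ (arity 1), $\mathbf{S}_2,\mathbf{F}_2$ (arity 2), and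 program symbols $\mathsf{app}$ (arity 2) and $\mathsf{fred}$ (arity 3): $\mathsf{app}(\mathbf{S}_0,x)\to\mathbf{S}_1(x)$; $\mathsf{app}(\mathbf{S}_1(x),y)\to\mathbf{S}_2(x,y)$; $\mathsf{app}(\mathbf{S}_2(x,y),z)\to\mathsf{app}(\mathsf{app}(x,z),\mathsf{app}(y,z))$; $\mathsf{app}(\mathbf{F}_0,x)\to\mathbf{F}_1(x)$; $\mathsf{app}(\mathbf{F}_1(x),y)\to\mathbf{F}_2(x,y)$; $\mathsf{app}(\mathbf{F}_2(x,y),z)\to\mathsf{fred}(x,y,z)$; $\mathsf{fred}(\mathbf{S}_0,y,z)\to y$; $\mathsf{fred}(\mathbf{F}_0,y,z)\to y$; $\mathsf{fred}(\mathbf{S}_1(x),y,z)\to\mathsf{app}(\mathsf{app}(z,\mathbf{S}_0),x)$; $\mathsf{fred}(\mathbf{F}_1(x),y,z)\to\mathsf{app}(\mathsf{app}(z,\mathbf{F}_0),x)$; $\mathsf{fred}(\mathbf{S}_2(p,q),y,z)\to\mathsf{app}(\mathsf{app}(z,\mathsf{app}(\mathbf{S}_0,p)),q)$; $\mathsf{fred}(\mathbf{F}_2(p,q),y,z)\to\mathsf{app}(\mathsf{app}(z,\mathsf{app}(\mathbf{F}_0,p)),q)$. Every rule has the form $f(c(x_1,\dots,x_m),y_1,\dots,y_n)\to b$ with $f$ a program symbol and $c$ a constructor, and there is exactly one rule for each pair $(f,c)$. Translation to rewrite terms: $[\![\mathbf{S}]\!]_{@}=\mathbf{S}_0$, $[\![\mathbf{F}]\!]_{@}=\mathbf{F}_0$,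 $[\![M\,N]\!]_{@}=\mathsf{app}([\![M]\!]_{@},[\![N]\!]_{@})$. Canonical representation (Berarducci–Böhm). Write $\langle t_1,\dots,t_n\rangle$ for $\lambda x.\,x\,t_1\cdots t_n$ and $\Pi^n_k = \lambda x_1\ldots x_n.\,x_k$. Enumerate the constructors as $c_1,\dots,c_r$ ($r=6$) and the programs as $f_1,\dots,f_k$ ($k=2$), in some fixed order. For a map $\phi$ from symbols to $\lambda$-terms, extend it to (extended) terms by $x^{\phi}=x$, $(\lambda x.M)^{\phi}=\lambda x.M^{\phi}$, $(MN)^{\phi}=M^{\phi}N^{\phi}$, $g(t_1,\dots,t_n)^{\phi}=\phi(g)\,t_1^{\phi}\cdots t_n^{\phi}$. Define $\vartheta(c_j)=\lambda x_1\ldots x_n f.\,f\,\Pi^r_j\,x_1\ldots x_n\,f$ where $n$ is the arity of $c_j$. Choose fresh distinct variables $v_1,\dots,v_k$ and set $\psi(f_i)=\langle v_i,\dots,v_k,v_1,\dots,v_{i-1}\rangle$. For the rule $f_i(c_j(x_1,\dots,x_m),y_1,\dots,y_n)\to b_{(i,j)}$ put $t_{(i,j)}=\lambda x_1\ldots x_m\,v_i\ldots v_k v_1\ldots v_{i-1}\,y_1\ldots y_n.\,((b_{(i,j)})^{\psi})^{\vartheta}$, $t_i=\langle t_{(i,1)},\dots,t_{(i,r)}\rangle$, and $\zeta(f_i)=\langle t_i,\dots,t_k,t_1,\dots,t_{i-1}\rangle$. Let $\phi_{\mathrm{SF}}=\vartheta\cup\zeta$. Finally $[\![M]\!]_{\lambda}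 = ([\![M]\!]_{@})^{\phi_{\mathrm{SF}}}$. $\rightarrow_{\beta}^{\ast}$ denotes multi-step $\beta$-reduction; a term is strongly normalising if it admits no infinite reduction sequence. -}

module Defs where

open import Data.Nat using (ℕ; zero; suc; _+_; _≟_)
open import Data.List using (List; []; _∷_; _++_; map; foldl; length)
open import Data.Maybe using (Maybe; just; nothing)
open import Relation.Nullary using (yes; no)
open import Relation.Binary.Construct.Closure.ReflexiveTransitive using (Star)
open import Induction.WellFounded using (Acc)

data SF : Set where
  S F : SF
  _·_ : SF → SF → SF

infixl 7 _·_

data Factorable : SF → Set where
  fS  : Factorable S
  fF  : Factorable F
  fS1 : ∀ M → Factorable (S · M)
  fF1 : ∀ M → Factorable (F · M)
  fS2 : ∀ M N → Factorable (S · M · N)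
  fF2 : ∀ M N → Factorable (F · M · N)

data Atom : SF → Set where
  aS : Atom S
  aF : Atom F

infix 4 _→SF_
data _→SF_ : SF → SF → Set where
  sRule : ∀ M N X → S · M · N · X →SF M · X · (N · X)
  fAtom : ∀ O M N → Atom O → F · O · M · N →SF M
  fComp : ∀ P Q M N → Factorable (P · Q) → F · (P · Q) · M · N →SF N · P · Q
  appL  : ∀ {M M'} N → M →SF M' → M · N →SF M' · N
  appR  : ∀ M {N N'} → N →SF N' → M · N →SF M · N'

infix 4 _→SF*_
_→SF*_ : SF → SF → Set
_→SF*_ = Star _→SF_

SN-SF : SF → Set
SN-SF = Acc (λ N M → M →SF N)

data Λ : Set where
  var : ℕ → Λ
  ƛ   : Λ → Λ
  _∙_ : Λ → Λ → Λ

infixl 7 _∙_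

ext : (ℕ → ℕ) → ℕ → ℕ
ext ρ zero    = zero
ext ρ (suc n) = suc (ρ n)

rename : (ℕ → ℕ) → Λ → Λ
rename ρ (var n) = var (ρ n)
rename ρ (ƛ t)   = ƛ (rename (ext ρ) t)
rename ρ (t ∙ u) = rename ρ t ∙ rename ρ u

exts : (ℕ → Λ) → ℕ → Λ
exts σ zero    = var zero
exts σ (suc n) = rename suc (σ n)

subst : (ℕ → Λ) → Λ → Λ
subst σ (var n) = σ n
subst σ (ƛ t)   = ƛ (subst (exts σ) t)
subst σ (t ∙ u) = subst σ t ∙ subst σ u

subst-zero : Λ → ℕ → Λ
subst-zero u zero    = u
subst-zero u (suc n) = var n

_[_] : Λ → Λ → Λ
t [ u ] = subst (subst-zero u) t

infix 4 _→β_
data _→β_ : Λ → Λ → Set where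
  β    : ∀ t u → ƛ t ∙ u →β t [ u ]
  ξ    : ∀ {t t'} → t →β t' → ƛ t →β ƛ t'
  appL : ∀ {t t'} u → t →β t' → t ∙ u →β t' ∙ u
  appR : ∀ t {u u'} → u →β u' → t ∙ u →β t ∙ u'

infix 4 _→β*_
_→β*_ : Λ → Λ → Set
_→β*_ = Star _→β_

SNβ : Λ → Set
SNβ = Acc (λ u t → t →β u)

-- named λ-terms (variable names are natural numbers), converted to
-- de Bruijn terms lexically (nearest enclosing binder)

Name : Set
Name = ℕ

data NΛ : Set where
  v   : Name → NΛ
  lam : Name → NΛ → NΛ
  _$_ : NΛ → NΛ → NΛ

infixl 7 _$_

index : Name → List Name → Maybe ℕ
index x [] = nothing
index x (y ∷ Γ) with x ≟ y
... | yes _ = just zero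
... | no _ with index x Γ
...   | just i  = just (suc i)
...   | nothing = nothing

toDB : List Name → NΛ → Λ
toDB Γ (v x) with index x Γ
... | just i  = var i
... | nothing = var (length Γ + x)
toDB Γ (lam x t) = ƛ (toDB (x ∷ Γ) t)
toDB Γ (t $ u)   = toDB Γ t ∙ toDB Γ u

lams : List Name → NΛ → NΛ
lams []       t = t
lams (x ∷ xs) t = lam x (lams xs t)

apps : NΛ → List NΛ → NΛ
apps = foldl _$_

-- ⟨ t₁ , … , tₙ ⟩ = λ b. b t₁ ⋯ tₙ  (b must not occur free in the tᵢ)
tuple : Name → List NΛ → NΛ
tuple b ts = lam b (apps (v b) ts)

-- Curryfied applicative SF-calculus as a first-order rewrite system

data Con : Set where
  S₀ S₁ S₂ F₀ F₁ F₂ : Con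

data Prog : Set where
  appP fredP : Prog

data RT : Set where
  rv    : Name → RT
  S0 F0 : RT
  S1 F1 : RT → RT
  S2 F2 : RT → RT → RT
  app   : RT → RT → RT
  fred  : RT → RT → RT → RT

x y z p q : Name
x = 0
y = 1
z = 2
p = 3
q = 4

-- the rules f(c(x₁..xₘ), y₁..yₙ) → b: pattern variables x̄, ȳ and rhs b
ruleXs : Prog → Con → List Name
ruleXs appP  S₀ = []
ruleXs appP  S₁ = x ∷ []
ruleXs appP  S₂ = x ∷ y ∷ []
ruleXs appP  F₀ = []
ruleXs appP  F₁ = x ∷ []
ruleXs appP  F₂ = x ∷ y ∷ []
ruleXs fredP S₀ = []
ruleXs fredP F₀ = []
ruleXs fredP S₁ = x ∷ []
ruleXs fredP F₁ = x ∷ []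
ruleXs fredP S₂ = p ∷ q ∷ []
ruleXs fredP F₂ = p ∷ q ∷ []

ruleYs : Prog → Con → List Name
ruleYs appP  S₀ = x ∷ []
ruleYs appP  S₁ = y ∷ []
ruleYs appP  S₂ = z ∷ []
ruleYs appP  F₀ = x ∷ []
ruleYs appP  F₁ = y ∷ []
ruleYs appP  F₂ = z ∷ []
ruleYs fredP _  = y ∷ z ∷ []

rhs : Prog → Con → RT
rhs appP  S₀ = S1 (rv x)
rhs appP  S₁ = S2 (rv x) (rv y)
rhs appP  S₂ = app (app (rv x) (rv z)) (app (rv y) (rv z))
rhs appP  F₀ = F1 (rv x)
rhs appP  F₁ = F2 (rv x) (rv y)
rhs appP  F₂ = fred (rv x) (rv y) (rv z)
rhs fredP S₀ = rv y
rhs fredP F₀ = rv y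
rhs fredP S₁ = app (app (rv z) S0) (rv x)
rhs fredP F₁ = app (app (rv z) F0) (rv x)
rhs fredP S₂ = app (app (rv z) (app S0 (rv p))) (rv q)
rhs fredP F₂ = app (app (rv z) (app F0 (rv p))) (rv q)

record SymMap : Set where
  field
    φc : Con → NΛ
    φp : Prog → NΛ
open SymMap

extend : SymMap → RT → NΛ
extend φ (rv n)       = v n
extend φ S0           = φc φ S₀
extend φ F0           = φc φ F₀
extend φ (S1 t)       = φc φ S₁ $ extend φ t
extend φ (F1 t)       = φc φ F₁ $ extend φ t
extend φ (S2 t u)     = φc φ S₂ $ extend φ t $ extend φ u
extend φ (F2 t u)     = φc φ F₂ $ extend φ t $ extend φ u
extend φ (app t u)    = φp φ appP $ extend φ t $ extend φ u
extend φ (fred t u w) = φp φ fredP $ extend φ t $ extend φ u $ extend φ w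

-- Berarducci–Böhm canonical representation
-- Fixed enumeration: c₁..c₆ = S₀,S₁,S₂,F₀,F₁,F₂ ; f₁ = app, f₂ = fred.

r : ℕ
r = 6

conIndex : Con → ℕ
conIndex S₀ = 1
conIndex S₁ = 2
conIndex S₂ = 3
conIndex F₀ = 4
conIndex F₁ = 5
conIndex F₂ = 6

arity : Con → ℕ
arity S₀ = 0
arity S₁ = 1
arity S₂ = 2
arity F₀ = 0
arity F₁ = 1
arity F₂ = 2

allCons : List Con
allCons = S₀ ∷ S₁ ∷ S₂ ∷ F₀ ∷ F₁ ∷ F₂ ∷ []

names : ℕ → ℕ → List Name
names b zero    = []
names b (suc n) = names b n ++ (b + suc n ∷ [])

-- Πʳⱼ = λ x₁ … xᵣ. xⱼ   (binders 41..46)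
Π : ℕ → ℕ → NΛ
Π n j = lams (names 40 n) (v (40 + j))

-- ϑ(cⱼ) = λ x₁ … xₙ f. f Πʳⱼ x₁ … xₙ f   (f = 30, xᵢ = 30+i)
ϑ : Con → NΛ
ϑ c = lams (names 30 (arity c) ++ (30 ∷ []))
           (apps (v 30) (Π r (conIndex c) ∷ map v (names 30 (arity c)) ++ (v 30 ∷ [])))

-- fresh variables v₁ = 10, v₂ = 11; cyclic order vᵢ … v_k v₁ … v_{i-1}
vOrder : Prog → List Name
vOrder appP  = 10 ∷ 11 ∷ []
vOrder fredP = 11 ∷ 10 ∷ []

-- ψ(fᵢ) = ⟨ vᵢ, …, v_k, v₁, …, v_{i-1} ⟩   (tuple binder 20)
ψ : Prog → NΛ
ψ f = tuple 20 (map v (vOrder f))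

-- map used for (b^ψ)^ϑ : ψ on programs, ϑ on constructors
ψϑ : SymMap
ψϑ = record { φc = ϑ ; φp = ψ }

-- t_(i,j) = λ x̄ vᵢ … v_{i-1} ȳ. ((b_(i,j))^ψ)^ϑ
tRule : Prog → Con → NΛ
tRule f c = lams (ruleXs f c ++ vOrder f ++ ruleYs f c) (extend ψϑ (rhs f c))

tProg : Prog → NΛ
tProg f = tuple 20 (map (tRule f) allCons)

progOrder : Prog → List Prog
progOrder appP  = appP ∷ fredP ∷ []
progOrder fredP = fredP ∷ appP ∷ []

-- ζ(fᵢ) = ⟨ tᵢ, …, t_k, t₁, …, t_{i-1} ⟩
ζ : Prog → NΛ
ζ f = tuple 20 (map tProg (progOrder f))

φSF : SymMap
φSF = record { φc = ϑ ; φp = ζ }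

⟦_⟧ₐ : SF → RT
⟦ S ⟧ₐ     = S0
⟦ F ⟧ₐ     = F0
⟦ M · N ⟧ₐ = app ⟦ M ⟧ₐ ⟦ N ⟧ₐ

⟦_⟧λ : SF → Λ
⟦ M ⟧λ = toDB [] (extend φSF ⟦ M ⟧ₐ)

-- Key fact: for each of the twelve rules f(c(x̄), ȳ) → b of the curryfied
-- system 𝓔, the term ζ(f) (ϑ(c) x̄) ȳ head-reduces to b^φ under every
-- substitution for the rule variables, and each argument substituted along the
-- way is a rule variable or a closed SN constant.
--
-- Reduction: each SF-step is a few 𝓔-steps, each simulated as above.
-- Strong normalisation: a ground 𝓔-term in an evaluation stack has an SN
-- translation, by induction on the denoted SF-term (ordered by reduction and
-- subterms), then on the number of app-nodes, then on the term; head
-- expansion reflects SN back along each rule.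

module Submission where

open import Defs
open import Data.Bool using (Bool; true; false; _∧_; if_then_else_)
open import Data.List using (List; []; _∷_; _++_; map; length)
open import Data.List.Relation.Unary.All using (All; []; _∷_)
open import Data.Maybe using (Maybe; just; nothing)
open import Data.Nat using (ℕ; zero; suc; _+_; _<_; _<ᵇ_; _≡ᵇ_; s≤s)
open import Data.Nat.Induction using (<-wellFounded)
open import Data.Nat.Properties using (n<1+n; +-monoˡ-<)
open import Data.Product using (_×_; _,_; Σ)
open import Data.Sum using (_⊎_; inj₁; inj₂)
open import Function using (_∘_)
open import Induction.WellFounded using (Acc; acc; acc-inverse)
open import Relation.Binary.Construct.Closure.ReflexiveTransitive
  using (ε; _◅_; _◅◅_; gmap; kleisliStar)
open import Relation.Binary.PropositionalEquality
  using (_≡_; refl; sym; trans; cong; cong₂) renaming (subst to transport; subst₂ to transport₂)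

-- De Bruijn substitution: congruence and fusion laws

ext-cong : ∀ {ρ ρ'} → (∀ i → ρ i ≡ ρ' i) → ∀ i → ext ρ i ≡ ext ρ' i
ext-cong e zero    = refl
ext-cong e (suc i) = cong suc (e i)

rename-cong : ∀ {ρ ρ'} → (∀ i → ρ i ≡ ρ' i) → ∀ t → rename ρ t ≡ rename ρ' t
rename-cong e (var n) = cong var (e n)
rename-cong e (ƛ t)   = cong ƛ (rename-cong (ext-cong e) t)
rename-cong e (t ∙ u) = cong₂ _∙_ (rename-cong e t) (rename-cong e u)

exts-cong : ∀ {σ τ} → (∀ i → σ i ≡ τ i) → ∀ i → exts σ i ≡ exts τ i
exts-cong e zero    = refl
exts-cong e (suc i) = cong (rename suc) (e i)

subst-cong : ∀ {σ τ} → (∀ i → σ i ≡ τ i) → ∀ t → subst σ t ≡ subst τ t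
subst-cong e (var n) = e n
subst-cong e (ƛ t)   = cong ƛ (subst-cong (exts-cong e) t)
subst-cong e (t ∙ u) = cong₂ _∙_ (subst-cong e t) (subst-cong e u)

rename-rename : ∀ ρ ρ' t → rename ρ (rename ρ' t) ≡ rename (ρ ∘ ρ') t
rename-rename ρ ρ' (var n) = refl
rename-rename ρ ρ' (ƛ t)   =
  cong ƛ (trans (rename-rename (ext ρ) (ext ρ') t) (rename-cong (λ { zero → refl ; (suc i) → refl }) t))
rename-rename ρ ρ' (t ∙ u) = cong₂ _∙_ (rename-rename ρ ρ' t) (rename-rename ρ ρ' u)

rename-subst : ∀ ρ σ t → rename ρ (subst σ t) ≡ subst (rename ρ ∘ σ) t
rename-subst ρ σ (var n) = refl
rename-subst ρ σ (ƛ t)   = cong ƛ (trans (rename-subst (ext ρ) (exts σ) t) (subst-cong lift t))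
  where
  lift : ∀ i → rename (ext ρ) (exts σ i) ≡ exts (rename ρ ∘ σ) i
  lift zero    = refl
  lift (suc i) = trans (rename-rename (ext ρ) suc (σ i)) (sym (rename-rename suc ρ (σ i)))
rename-subst ρ σ (t ∙ u) = cong₂ _∙_ (rename-subst ρ σ t) (rename-subst ρ σ u)

subst-rename : ∀ σ ρ t → subst σ (rename ρ t) ≡ subst (σ ∘ ρ) t
subst-rename σ ρ (var n) = refl
subst-rename σ ρ (ƛ t)   =
  cong ƛ (trans (subst-rename (exts σ) (ext ρ) t) (subst-cong (λ { zero → refl ; (suc i) → refl }) t))
subst-rename σ ρ (t ∙ u) = cong₂ _∙_ (subst-rename σ ρ t) (subst-rename σ ρ u)

subst-subst : ∀ σ τ t → subst σ (subst τ t) ≡ subst (subst σ ∘ τ) t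
subst-subst σ τ (var n) = refl
subst-subst σ τ (ƛ t)   = cong ƛ (trans (subst-subst (exts σ) (exts τ) t) (subst-cong lift t))
  where
  lift : ∀ i → subst (exts σ) (exts τ i) ≡ exts (subst σ ∘ τ) i
  lift zero    = refl
  lift (suc i) = trans (subst-rename (exts σ) suc (τ i)) (sym (rename-subst suc σ (τ i)))
subst-subst σ τ (t ∙ u) = cong₂ _∙_ (subst-subst σ τ t) (subst-subst σ τ u)

subst-id : ∀ {σ} → (∀ i → σ i ≡ var i) → ∀ t → subst σ t ≡ t
subst-id e t = trans (subst-cong e t) (subst-var t)
  where
  subst-var : ∀ t → subst var t ≡ t
  subst-var (var n) = refl
  subst-var (ƛ t)   = cong ƛ (trans (subst-cong (λ { zero → refl ; (suc i) → refl }) t) (subst-var t))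
  subst-var (t ∙ u) = cong₂ _∙_ (subst-var t) (subst-var u)

rename-as-subst : ∀ ρ t → rename ρ t ≡ subst (var ∘ ρ) t
rename-as-subst ρ t = trans (sym (subst-id (λ i → refl) (rename ρ t))) (subst-rename var ρ t)

instantiate-weaken : ∀ t u → rename suc t [ u ] ≡ t
instantiate-weaken t u = trans (subst-rename (subst-zero u) suc t) (subst-id (λ i → refl) t)

subst-[] : ∀ σ t u → subst σ (t [ u ]) ≡ subst (exts σ) t [ subst σ u ]
subst-[] σ t u =
  trans (subst-subst σ (subst-zero u) t)
        (trans (subst-cong agree t) (sym (subst-subst (subst-zero (subst σ u)) (exts σ) t)))
  where
  agree : ∀ i → subst σ (subst-zero u i) ≡ subst (subst-zero (subst σ u)) (exts σ i)
  agree zero    = refl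
  agree (suc i) = sym (instantiate-weaken (σ i) (subst σ u))

subst-→β : ∀ σ {t t'} → t →β t' → subst σ t →β subst σ t'
subst-→β σ (β t u)    = transport (subst σ (ƛ t ∙ u) →β_) (sym (subst-[] σ t u)) (β _ _)
subst-→β σ (ξ s)      = ξ (subst-→β (exts σ) s)
subst-→β σ (appL u s) = appL _ (subst-→β σ s)
subst-→β σ (appR t s) = appR _ (subst-→β σ s)

rename-→β : ∀ ρ {t t'} → t →β t' → rename ρ t →β rename ρ t'
rename-→β ρ {t} {t'} s =
  transport₂ _→β_ (sym (rename-as-subst ρ t)) (sym (rename-as-subst ρ t')) (subst-→β (var ∘ ρ) s)

subst-→β* : ∀ {σ τ} → (∀ i → σ i →β* τ i) → ∀ t → subst σ t →β* subst τ t
subst-→β* h (var n) = h n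
subst-→β* {σ} {τ} h (ƛ t) = gmap ƛ ξ (subst-→β* lift t)
  where
  lift : ∀ i → exts σ i →β* exts τ i
  lift zero    = ε
  lift (suc i) = gmap (rename suc) (rename-→β suc) (h i)
subst-→β* {σ} {τ} h (t ∙ u) =
  gmap (_∙ subst σ u) (appL _) (subst-→β* h t) ◅◅ gmap (subst τ t ∙_) (appR _) (subst-→β* h u)

[]-→β* : ∀ t {u u'} → u →β u' → t [ u ] →β* t [ u' ]
[]-→β* t s = subst-→β* (λ { zero → s ◅ ε ; (suc i) → ε }) t

-- Spines  t a₁ … aₙ, stored with the outermost argument first

infixl 6 _⋯_
_⋯_ : Λ → List Λ → Λ
t ⋯ []       = t
t ⋯ (a ∷ as) = (t ⋯ as) ∙ a

⋯-++ : ∀ t as bs → t ⋯ (as ++ bs) ≡ (t ⋯ bs) ⋯ as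
⋯-++ t []       bs = refl
⋯-++ t (a ∷ as) bs = cong (_∙ a) (⋯-++ t as bs)

infix 4 _→ₛ_
data _→ₛ_ : List Λ → List Λ → Set where
  here  : ∀ {a a'} as → a →β a' → (a ∷ as) →ₛ (a' ∷ as)
  there : ∀ a {as as'} → as →ₛ as' → (a ∷ as) →ₛ (a ∷ as')

⋯-headL : ∀ {t t'} as → t →β t' → t ⋯ as →β t' ⋯ as
⋯-headL []       s = s
⋯-headL (a ∷ as) s = appL a (⋯-headL as s)

⋯-args : ∀ t {as as'} → as →ₛ as' → t ⋯ as →β t ⋯ as'
⋯-args t (here as s)  = appR _ s
⋯-args t (there a s) = appL a (⋯-args t s)

SN-→β* : ∀ {t t'} → SNβ t → t →β* t' → SNβ t'
SN-→β* sn       ε        = sn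
SN-→β* (acc sn) (s ◅ ss) = SN-→β* (sn s) ss

SN-appL : ∀ {t a} → SNβ (t ∙ a) → SNβ t
SN-appL (acc sn) = acc λ s → SN-appL (sn (appL _ s))

SN-head : ∀ {t} as → SNβ (t ⋯ as) → SNβ t
SN-head []       sn = sn
SN-head (a ∷ as) sn = SN-head as (SN-appL sn)

SN-ƛ : ∀ {t} → SNβ t → SNβ (ƛ t)
SN-ƛ (acc sn) = acc λ { (ξ s) → SN-ƛ (sn s) }

-- SN is reflected by substitution, hence preserved by weakening.
SN-unsubst : ∀ σ {t} → SNβ (subst σ t) → SNβ t
SN-unsubst σ (acc sn) = acc λ s → SN-unsubst σ (sn (subst-→β σ s))

SN-weaken : ∀ {t} → SNβ t → SNβ (rename suc t)
SN-weaken {t} sn = SN-unsubst (subst-zero t) (transport SNβ (sym (instantiate-weaken t t)) sn)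

-- Neutral terms: a variable applied to SN arguments is SN.  The induction is on
-- the lexicographic product of the arguments' SN, i.e. accessibility for →ₛ.
private
  SNₛ : List Λ → Set
  SNₛ = Acc (λ as' as → as →ₛ as')

  SNₛ-∷ : ∀ {a as} → SNβ a → SNₛ as → SNₛ (a ∷ as)
  SNₛ-∷ (acc sa) (acc sas) = acc λ
    { (here _ s)  → SNₛ-∷ (sa s) (acc sas)
    ; (there _ s) → SNₛ-∷ (acc sa) (sas s) }

  All-SNₛ : ∀ {as} → All SNβ as → SNₛ as
  All-SNₛ []         = acc λ ()
  All-SNₛ (sa ∷ sas) = SNₛ-∷ sa (All-SNₛ sas)

  neutral-step : ∀ n as {w} → var n ⋯ as →β w → Σ (List Λ) λ as' → as →ₛ as' × w ≡ var n ⋯ as'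
  neutral-step n (a ∷ [])     (appR _ s) = _ , here [] s , refl
  neutral-step n (a ∷ b ∷ as) (appR _ s) = _ , here _ s , refl
  neutral-step n (a ∷ b ∷ as) (appL _ s) with neutral-step n (b ∷ as) s
  ... | as' , s' , refl = a ∷ as' , there a s' , refl

  neutral-SNₛ : ∀ n {as} → SNₛ as → SNβ (var n ⋯ as)
  neutral-SNₛ n {as} (acc sas) = acc λ s → step (neutral-step n as s)
    where
    step : ∀ {w} → Σ (List Λ) (λ as' → as →ₛ as' × w ≡ var n ⋯ as') → SNβ w
    step (as' , s , refl) = neutral-SNₛ n (sas s)

neutral-SN : ∀ n {as} → All SNβ as → SNβ (var n ⋯ as)
neutral-SN n sas = neutral-SNₛ n (All-SNₛ sas)

var-SN : ∀ n → SNβ (var n)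
var-SN n = neutral-SN n []

-- Head expansion.  A step from (λs) u a₁ … aₙ contracts the head redex or
-- reduces s, u or some aᵢ; the lemma below is proved by induction on the SN of
-- u and of the contractum s[u] a₁ … aₙ.
private
  data RedexStep (s u : Λ) (as : List Λ) : Λ → Set where
    contract : RedexStep s u as (s [ u ] ⋯ as)
    inBody   : ∀ {s'} → s →β s' → RedexStep s u as ((ƛ s' ∙ u) ⋯ as)
    inArg    : ∀ {u'} → u →β u' → RedexStep s u as ((ƛ s ∙ u') ⋯ as)
    inSpine  : ∀ {as'} → as →ₛ as' → RedexStep s u as ((ƛ s ∙ u) ⋯ as')

  redexStep-∷ : ∀ {s u as w} a → RedexStep s u as w → RedexStep s u (a ∷ as) (w ∙ a)
  redexStep-∷ a contract    = contract
  redexStep-∷ a (inBody s)  = inBody s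
  redexStep-∷ a (inArg s)   = inArg s
  redexStep-∷ a (inSpine s) = inSpine (there a s)

  redex-step : ∀ s u as {w} → (ƛ s ∙ u) ⋯ as →β w → RedexStep s u as w
  redex-step s u []           (β _ _)           = contract
  redex-step s u []           (appL _ (ξ step)) = inBody step
  redex-step s u []           (appR _ step)     = inArg step
  redex-step s u (a ∷ [])     (appL _ step)     = redexStep-∷ a (redex-step s u [] step)
  redex-step s u (a ∷ b ∷ as) (appL _ step)     = redexStep-∷ a (redex-step s u (b ∷ as) step)
  redex-step s u (a ∷ [])     (appR _ step)     = inSpine (here [] step)
  redex-step s u (a ∷ b ∷ as) (appR _ step)     = inSpine (here _ step)

  expand : ∀ {u} → SNβ u → ∀ s as → SNβ (s [ u ] ⋯ as) → SNβ ((ƛ s ∙ u) ⋯ as)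
  expand {u} su s as sn = acc λ step → after su s as sn (redex-step s u as step)
    where
    after : ∀ {u} → SNβ u → ∀ s as → SNβ (s [ u ] ⋯ as) → ∀ {w} → RedexStep s u as w → SNβ w
    after su       s as sn       contract    = sn
    after su       s as (acc sn) (inBody st) = expand su _ as (sn (⋯-headL as (subst-→β _ st)))
    after (acc su) s as sn       (inArg st)  =
      expand (su st) s as (SN-→β* sn (gmap (_⋯ as) (⋯-headL as) ([]-→β* s st)))
    after su       s as (acc sn) (inSpine st) = expand su s _ (sn (⋯-args _ st))

SN-reflects : Λ → Λ → Set
SN-reflects t t' = ∀ L → SNβ (t' ⋯ L) → SNβ (t ⋯ L)

β-reflects : ∀ s {u} → SNβ u → SN-reflects (ƛ s ∙ u) (s [ u ])
β-reflects s su L = expand su s L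

reflects-∙ : ∀ {t t'} a → SN-reflects t t' → SN-reflects (t ∙ a) (t' ∙ a)
reflects-∙ {t} {t'} a h L sn =
  transport SNβ (⋯-++ t L (a ∷ [])) (h (L ++ a ∷ []) (transport SNβ (sym (⋯-++ t' L (a ∷ []))) sn))

-- A sound, fuel-bounded SN checker

∧-true : ∀ {a b} → (a ∧ b) ≡ true → a ≡ true × b ≡ true
∧-true {true} e = refl , e

data Shape : Λ → Set where
  neutral : ∀ n as → Shape (var n ⋯ as)
  lambda  : ∀ t → Shape (ƛ t)
  redex   : ∀ s u as → Shape ((ƛ s ∙ u) ⋯ as)

shape : ∀ t → Shape t
shape (var n) = neutral n []
shape (ƛ t)   = lambda t
shape (t ∙ a) with shape t
... | neutral n as = neutral n (a ∷ as)
... | lambda s     = redex s a []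
... | redex s u as = redex s u (a ∷ as)

-- checkSN n t explores the reducts of t shape by shape, with fuel n; it is
-- sound by the neutral-term and head-expansion lemmas
checkSN : ℕ → Λ → Bool
checkShape : ℕ → ∀ {t} → Shape t → Bool
checkAll : ℕ → List Λ → Bool
checkSN zero    t = false
checkSN (suc n) t = checkShape n (shape t)
checkShape n (neutral m as) = checkAll n as
checkShape n (lambda t)     = checkSN n t
checkShape n (redex s u as) = checkSN n u ∧ checkSN n (s [ u ] ⋯ as)
checkAll n []       = true
checkAll n (a ∷ as) = checkSN n a ∧ checkAll n as

checkSN-sound : ∀ n t → checkSN n t ≡ true → SNβ t
checkShape-sound : ∀ n {t} (w : Shape t) → checkShape n w ≡ true → SNβ t
checkAll-sound : ∀ n as → checkAll n as ≡ true → All SNβ as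
checkSN-sound (suc n) t e = checkShape-sound n (shape t) e
checkShape-sound n (neutral m as) e = neutral-SN m (checkAll-sound n as e)
checkShape-sound n (lambda t)     e = SN-ƛ (checkSN-sound n t e)
checkShape-sound n (redex s u as) e with ∧-true e
... | eu , es = expand (checkSN-sound n u eu) s as (checkSN-sound n _ es)
checkAll-sound n []       e = []
checkAll-sound n (a ∷ as) e with ∧-true e
... | ea , eas = checkSN-sound n a ea ∷ checkAll-sound n as eas

-- Certified head reduction of open terms

-- one step of head reduction, returning the contractum and the argument that
-- was substituted
headStep : Λ → Maybe (Λ × Λ)
headStep (ƛ s ∙ u) = just (s [ u ] , u)
headStep (t ∙ a) with headStep t
... | just (t' , u) = just (t' ∙ a , u)
... | nothing       = nothing
headStep _ = nothing

data HeadStep : Λ → Λ → Λ → Set where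
  headRedex : ∀ s u as → HeadStep ((ƛ s ∙ u) ⋯ as) (s [ u ] ⋯ as) u

headStep-∙ : ∀ {t t' u} a → HeadStep t t' u → HeadStep (t ∙ a) (t' ∙ a) u
headStep-∙ a (headRedex s u as) = headRedex s u (a ∷ as)

headStep-sound : ∀ t {t' u} → headStep t ≡ just (t' , u) → HeadStep t t' u
headStep-sound (ƛ s ∙ u)     refl = headRedex s u []
headStep-sound ((t ∙ b) ∙ a) e with headStep (t ∙ b) in eq
headStep-sound ((t ∙ b) ∙ a) refl | just (t' , u) = headStep-∙ a (headStep-sound (t ∙ b) eq)

subst-⋯ : ∀ σ t as → subst σ (t ⋯ as) ≡ subst σ t ⋯ map (subst σ) as
subst-⋯ σ t []       = refl
subst-⋯ σ t (a ∷ as) = cong (_∙ subst σ a) (subst-⋯ σ t as)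

headStep-→β : ∀ σ {t t' u} → HeadStep t t' u → subst σ t →β subst σ t'
headStep-→β σ (headRedex s u as) = subst-→β σ (⋯-headL as (β s u))

headStep-reflects : ∀ σ {t t' u} → HeadStep t t' u → SNβ (subst σ u) →
                    SN-reflects (subst σ t) (subst σ t')
headStep-reflects σ (headRedex s u as) su L sn =
  transport SNβ (sym redex-form) (expand su (subst (exts σ) s) (L ++ map (subst σ) as) (transport SNβ contractum-form sn))
  where
  redex-form : subst σ ((ƛ s ∙ u) ⋯ as) ⋯ L ≡ (ƛ (subst (exts σ) s) ∙ subst σ u) ⋯ (L ++ map (subst σ) as)
  redex-form = trans (cong (_⋯ L) (subst-⋯ σ _ as)) (sym (⋯-++ _ L _))
  contractum-form : subst σ (s [ u ] ⋯ as) ⋯ L ≡ subst (exts σ) s [ subst σ u ] ⋯ (L ++ map (subst σ) as)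
  contractum-form =
    trans (cong (_⋯ L) (trans (subst-⋯ σ _ as) (cong (_⋯ map (subst σ) as) (subst-[] σ s u)))) (sym (⋯-++ _ L _))

closed : ℕ → Λ → Bool
closed k (var n) = n <ᵇ k
closed k (ƛ t)   = closed (suc k) t
closed k (t ∙ u) = closed k t ∧ closed k u

closed-subst : ∀ k t σ → closed k t ≡ true → (∀ i → (i <ᵇ k) ≡ true → σ i ≡ var i) → subst σ t ≡ t
closed-subst k (var n) σ c h = h n c
closed-subst k (ƛ t)   σ c h = cong ƛ (closed-subst (suc k) t (exts σ) c lift)
  where
  lift : ∀ i → (i <ᵇ suc k) ≡ true → exts σ i ≡ var i
  lift zero    _ = refl
  lift (suc i) e = cong (rename suc) (h i e)
closed-subst k (t ∙ u) σ c h with ∧-true c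
... | ct , cu = cong₂ _∙_ (closed-subst k t σ ct h) (closed-subst k u σ cu h)

certified-SN : ∀ σ t → (closed 0 t ∧ checkSN 200 t) ≡ true → SNβ (subst σ t)
certified-SN σ t e with ∧-true e
... | c , s = transport SNβ (sym (closed-subst 0 t σ c λ _ ())) (checkSN-sound 200 t s)

harmless : Λ → Bool
harmless (var _) = true
harmless t       = closed 0 t ∧ checkSN 200 t

harmless-SN : ∀ σ → (∀ i → SNβ (σ i)) → ∀ u → harmless u ≡ true → SNβ (subst σ u)
harmless-SN σ sσ (var n) e = sσ n
harmless-SN σ sσ (ƛ u)   e = certified-SN σ (ƛ u) e
harmless-SN σ sσ (u ∙ a) e = certified-SN σ (u ∙ a) e

evaluate : ℕ → Λ → Maybe Λ
evaluate zero    t = just t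
evaluate (suc n) t with headStep t
... | nothing      = nothing
... | just (t' , u) = if harmless u then evaluate n t' else nothing

evaluate-→β* : ∀ σ n t {t'} → evaluate n t ≡ just t' → subst σ t →β* subst σ t'
evaluate-→β* σ zero    t refl = ε
evaluate-→β* σ (suc n) t e with headStep t in eq
... | just (t'' , u) with harmless u
...   | true = headStep-→β σ (headStep-sound t eq) ◅ evaluate-→β* σ n t'' e

evaluate-reflects : ∀ σ → (∀ i → SNβ (σ i)) → ∀ n t {t'} → evaluate n t ≡ just t' →
                    SN-reflects (subst σ t) (subst σ t')
evaluate-reflects σ sσ zero    t refl L sn = sn
evaluate-reflects σ sσ (suc n) t e    L sn with headStep t in eq
... | just (t'' , u) with harmless u in ok
...   | true = headStep-reflects σ (headStep-sound t eq) (harmless-SN σ sσ u ok) L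
                 (evaluate-reflects σ sσ n t'' e L sn)

-- The rules of 𝓔 in the representation

-- Open translation: a rule variable named n becomes the free index n.
⟦_⟧ᵒ : RT → Λ
⟦ t ⟧ᵒ = toDB [] (extend φSF t)

Zapp Zfred Tapp Tfred : Λ
Zapp  = toDB [] (ζ appP)
Zfred = toDB [] (ζ fredP)
Tapp  = toDB [] (tProg appP)
Tfred = toDB [] (tProg fredP)

θ : Con → Λ
θ c = toDB [] (ϑ c)

infixr 5 _≔_⨾_
_≔_⨾_ : Name → Λ → (Name → Λ) → Name → Λ
(n ≔ a ⨾ σ) i = if i ≡ᵇ n then a else σ i

≔-SN : ∀ n {a σ} → SNβ a → (∀ i → SNβ (σ i)) → ∀ i → SNβ ((n ≔ a ⨾ σ) i)
≔-SN n sa sσ i with i ≡ᵇ n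
... | true  = sa
... | false = sσ i

ζapp-→β : ∀ a b → Zapp ∙ a ∙ b →β a ∙ Tapp ∙ Tfred ∙ b
ζapp-→β a b = appL b (β _ a)

ζfred-→β : ∀ a m n → Zfred ∙ a ∙ m ∙ n →β a ∙ Tfred ∙ Tapp ∙ m ∙ n
ζfred-→β a m n = appL n (appL m (β _ a))

ζapp-reflects : ∀ a b → SN-reflects (Zapp ∙ a ∙ b) (a ∙ Tapp ∙ Tfred ∙ b)
ζapp-reflects a b = reflects-∙ b λ L sn →
  β-reflects (var 0 ∙ Tapp ∙ Tfred) (SN-head (Tfred ∷ Tapp ∷ []) (SN-head L sn)) L sn

ζfred-reflects : ∀ a m n → SN-reflects (Zfred ∙ a ∙ m ∙ n) (a ∙ Tfred ∙ Tapp ∙ m ∙ n)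
ζfred-reflects a m n = reflects-∙ n (reflects-∙ m λ L sn →
  β-reflects (var 0 ∙ Tfred ∙ Tapp) (SN-head (Tapp ∷ Tfred ∷ []) (SN-head L sn)) L sn)

-- The unfolded left-hand side ϑ(c) x̄ t_f … ȳ of the rule for (f, c), the
-- right-hand side b^φ, and the number of head steps between them: ϑ(c) consumes
-- x̄ and the first tuple, that tuple selects t_(f,c) through Πʳⱼ, and t_(f,c)
-- consumes x̄, the tuples and ȳ.
ruleLhs : Prog → Con → Λ
ruleLhs f c = toDB [] (apps (ϑ c) (map v (ruleXs f c) ++ map tProg (progOrder f) ++ map v (ruleYs f c)))

ruleRhs : Prog → Con → Λ
ruleRhs f c = ⟦ rhs f c ⟧ᵒ

ruleSteps : Prog → Con → ℕ
ruleSteps f c = (arity c + 1) + (1 + r) + (arity c + length (vOrder f) + length (ruleYs f c))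

rule-evaluates : ∀ f c → evaluate (ruleSteps f c) (ruleLhs f c) ≡ just (ruleRhs f c)
rule-evaluates appP  S₀ = refl
rule-evaluates appP  S₁ = refl
rule-evaluates appP  S₂ = refl
rule-evaluates appP  F₀ = refl
rule-evaluates appP  F₁ = refl
rule-evaluates appP  F₂ = refl
rule-evaluates fredP S₀ = refl
rule-evaluates fredP S₁ = refl
rule-evaluates fredP S₂ = refl
rule-evaluates fredP F₀ = refl
rule-evaluates fredP F₁ = refl
rule-evaluates fredP F₂ = refl

rule-→β* : ∀ f c σ → subst σ (ruleLhs f c) →β* subst σ (ruleRhs f c)
rule-→β* f c σ = evaluate-→β* σ (ruleSteps f c) (ruleLhs f c) (rule-evaluates f c)

rule-reflects : ∀ f c σ → (∀ i → SNβ (σ i)) → SN-reflects (subst σ (ruleLhs f c)) (subst σ (ruleRhs f c))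
rule-reflects f c σ sσ = evaluate-reflects σ sσ (ruleSteps f c) (ruleLhs f c) (rule-evaluates f c)

conPattern : Con → Λ
conPattern c = toDB [] (apps (ϑ c) (map v (ruleXs appP c)))

select : Con → Λ
select c = toDB [] (Π r (conIndex c))

value₁ value₂ : Con → Λ
value₁ c = ƛ (var 0 ∙ select c ∙ var 1 ∙ var 0)
value₂ c = ƛ (var 0 ∙ select c ∙ var 1 ∙ var 2 ∙ var 0)

selector-SN : ∀ c → SNβ (select c)
selector-SN S₀ = checkSN-sound 10 (select S₀) refl
selector-SN S₁ = checkSN-sound 10 (select S₁) refl
selector-SN S₂ = checkSN-sound 10 (select S₂) refl
selector-SN F₀ = checkSN-sound 10 (select F₀) refl
selector-SN F₁ = checkSN-sound 10 (select F₁) refl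
selector-SN F₂ = checkSN-sound 10 (select F₂) refl

value₁-SN : ∀ c {a} → SNβ a → SNβ (ƛ (var 0 ∙ select c ∙ rename suc a ∙ var 0))
value₁-SN c sa = SN-ƛ (neutral-SN 0 (var-SN 0 ∷ SN-weaken sa ∷ selector-SN c ∷ []))

value₂-SN : ∀ c {a b} → SNβ a → SNβ b → SNβ (ƛ (var 0 ∙ select c ∙ rename suc a ∙ rename suc b ∙ var 0))
value₂-SN c sa sb = SN-ƛ (neutral-SN 0 (var-SN 0 ∷ SN-weaken sb ∷ SN-weaken sa ∷ selector-SN c ∷ []))

-- ϑ(c) applied to SN arguments is SN, because its value is.
con-SN : ∀ c σ → (∀ i → SNβ (σ i)) → SNβ (subst σ (conPattern c))
con-SN S₀ _ _ = checkSN-sound 200 (θ S₀) refl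
con-SN F₀ _ _ = checkSN-sound 200 (θ F₀) refl
con-SN S₁ σ sσ = evaluate-reflects σ sσ 1 (conPattern S₁) {value₁ S₁} refl [] (value₁-SN S₁ (sσ x))
con-SN F₁ σ sσ = evaluate-reflects σ sσ 1 (conPattern F₁) {value₁ F₁} refl [] (value₁-SN F₁ (sσ x))
con-SN S₂ σ sσ = evaluate-reflects σ sσ 2 (conPattern S₂) {value₂ S₂} refl [] (value₂-SN S₂ (sσ x) (sσ y))
con-SN F₂ σ sσ = evaluate-reflects σ sσ 2 (conPattern F₂) {value₂ F₂} refl [] (value₂-SN F₂ (sσ x) (sσ y))

-- Preservation of reduction

appS₀ : ∀ a → Zapp ∙ θ S₀ ∙ a →β* θ S₁ ∙ a
appS₀ a = ζapp-→β _ _ ◅ rule-→β* appP S₀ (x ≔ a ⨾ var)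

appS₁ : ∀ a b → Zapp ∙ (θ S₁ ∙ a) ∙ b →β* θ S₂ ∙ a ∙ b
appS₁ a b = ζapp-→β _ _ ◅ rule-→β* appP S₁ (x ≔ a ⨾ y ≔ b ⨾ var)

appS₂ : ∀ a b c → Zapp ∙ (θ S₂ ∙ a ∙ b) ∙ c →β* Zapp ∙ (Zapp ∙ a ∙ c) ∙ (Zapp ∙ b ∙ c)
appS₂ a b c = ζapp-→β _ _ ◅ rule-→β* appP S₂ (x ≔ a ⨾ y ≔ b ⨾ z ≔ c ⨾ var)

appF₀ : ∀ a → Zapp ∙ θ F₀ ∙ a →β* θ F₁ ∙ a
appF₀ a = ζapp-→β _ _ ◅ rule-→β* appP F₀ (x ≔ a ⨾ var)

appF₁ : ∀ a b → Zapp ∙ (θ F₁ ∙ a) ∙ b →β* θ F₂ ∙ a ∙ b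
appF₁ a b = ζapp-→β _ _ ◅ rule-→β* appP F₁ (x ≔ a ⨾ y ≔ b ⨾ var)

appF₂ : ∀ a b c → Zapp ∙ (θ F₂ ∙ a ∙ b) ∙ c →β* Zfred ∙ a ∙ b ∙ c
appF₂ a b c = ζapp-→β _ _ ◅ rule-→β* appP F₂ (x ≔ a ⨾ y ≔ b ⨾ z ≔ c ⨾ var)

fredS₀ : ∀ m n → Zfred ∙ θ S₀ ∙ m ∙ n →β* m
fredS₀ m n = ζfred-→β _ _ _ ◅ rule-→β* fredP S₀ (y ≔ m ⨾ z ≔ n ⨾ var)

fredF₀ : ∀ m n → Zfred ∙ θ F₀ ∙ m ∙ n →β* m
fredF₀ m n = ζfred-→β _ _ _ ◅ rule-→β* fredP F₀ (y ≔ m ⨾ z ≔ n ⨾ var)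

fredS₁ : ∀ a m n → Zfred ∙ (θ S₁ ∙ a) ∙ m ∙ n →β* Zapp ∙ (Zapp ∙ n ∙ θ S₀) ∙ a
fredS₁ a m n = ζfred-→β _ _ _ ◅ rule-→β* fredP S₁ (x ≔ a ⨾ y ≔ m ⨾ z ≔ n ⨾ var)

fredF₁ : ∀ a m n → Zfred ∙ (θ F₁ ∙ a) ∙ m ∙ n →β* Zapp ∙ (Zapp ∙ n ∙ θ F₀) ∙ a
fredF₁ a m n = ζfred-→β _ _ _ ◅ rule-→β* fredP F₁ (x ≔ a ⨾ y ≔ m ⨾ z ≔ n ⨾ var)

fredS₂ : ∀ a b m n → Zfred ∙ (θ S₂ ∙ a ∙ b) ∙ m ∙ n →β* Zapp ∙ (Zapp ∙ n ∙ (Zapp ∙ θ S₀ ∙ a)) ∙ b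
fredS₂ a b m n = ζfred-→β _ _ _ ◅ rule-→β* fredP S₂ (p ≔ a ⨾ q ≔ b ⨾ y ≔ m ⨾ z ≔ n ⨾ var)

fredF₂ : ∀ a b m n → Zfred ∙ (θ F₂ ∙ a ∙ b) ∙ m ∙ n →β* Zapp ∙ (Zapp ∙ n ∙ (Zapp ∙ θ F₀ ∙ a)) ∙ b
fredF₂ a b m n = ζfred-→β _ _ _ ◅ rule-→β* fredP F₂ (p ≔ a ⨾ q ≔ b ⨾ y ≔ m ⨾ z ≔ n ⨾ var)

app-congˡ : ∀ {a a'} b → a →β* a' → Zapp ∙ a ∙ b →β* Zapp ∙ a' ∙ b
app-congˡ b = gmap (λ t → Zapp ∙ t ∙ b) (λ s → appL b (appR Zapp s))

app-congʳ : ∀ a {b b'} → b →β* b' → Zapp ∙ a ∙ b →β* Zapp ∙ a ∙ b'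
app-congʳ a = gmap (Zapp ∙ a ∙_) (appR (Zapp ∙ a))

fred-cong : ∀ {o o'} m n → o →β* o' → Zfred ∙ o ∙ m ∙ n →β* Zfred ∙ o' ∙ m ∙ n
fred-cong m n = gmap (λ t → Zfred ∙ t ∙ m ∙ n) (λ s → appL n (appL m (appR Zfred s)))

F-spine : ∀ o m n → Zapp ∙ (Zapp ∙ (Zapp ∙ θ F₀ ∙ o) ∙ m) ∙ n →β* Zfred ∙ o ∙ m ∙ n
F-spine o m n = app-congˡ n (app-congˡ m (appF₀ o)) ◅◅ app-congˡ n (appF₁ o m) ◅◅ appF₂ o m n

simulate-step : ∀ {M N} → M →SF N → ⟦ M ⟧λ →β* ⟦ N ⟧λ
simulate-step (sRule _ _ _) =
  app-congˡ _ (app-congˡ _ (appS₀ _)) ◅◅ app-congˡ _ (appS₁ _ _) ◅◅ appS₂ _ _ _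
simulate-step (fAtom _ _ _ aS) = F-spine _ _ _ ◅◅ fredS₀ _ _
simulate-step (fAtom _ _ _ aF) = F-spine _ _ _ ◅◅ fredF₀ _ _
simulate-step (fComp _ _ _ _ (fS1 _)) =
  F-spine _ _ _ ◅◅ fred-cong _ _ (appS₀ _) ◅◅ fredS₁ _ _ _
simulate-step (fComp _ _ _ _ (fF1 _)) =
  F-spine _ _ _ ◅◅ fred-cong _ _ (appF₀ _) ◅◅ fredF₁ _ _ _
simulate-step (fComp _ _ _ _ (fS2 _ _)) =
  F-spine _ _ _ ◅◅ fred-cong _ _ (app-congˡ _ (appS₀ _) ◅◅ appS₁ _ _) ◅◅ fredS₂ _ _ _ _
simulate-step (fComp _ _ _ _ (fF2 _ _)) =
  F-spine _ _ _ ◅◅ fred-cong _ _ (app-congˡ _ (appF₀ _) ◅◅ appF₁ _ _) ◅◅ fredF₂ _ _ _ _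
simulate-step (appL _ s) = app-congˡ _ (simulate-step s)
simulate-step (appR _ s) = app-congʳ _ (simulate-step s)

simulate : ∀ {M N} → M →SF* N → ⟦ M ⟧λ →β* ⟦ N ⟧λ
simulate = kleisliStar ⟦_⟧λ simulate-step

-- Preservation of strong normalisation: the SF side

infix 4 _◁_ _⊴_
data _◁_ : SF → SF → Set where
  subL  : ∀ A B → A ◁ A · B
  subR  : ∀ A B → B ◁ A · B
  deepL : ∀ {N A} B → N ◁ A → N ◁ A · B
  deepR : ∀ {N B} A → N ◁ B → N ◁ A · B

data _⊴_ : SF → SF → Set where
  self : ∀ {M} → M ⊴ M
  inL  : ∀ {N A} B → N ⊴ A → N ⊴ A · B
  inR  : ∀ {N B} A → N ⊴ B → N ⊴ A · B

⊴-trans : ∀ {N N' M} → N ⊴ N' → N' ⊴ M → N ⊴ M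
⊴-trans s self      = s
⊴-trans s (inL B p) = inL B (⊴-trans s p)
⊴-trans s (inR A p) = inR A (⊴-trans s p)

⊴-step : ∀ {N M N'} → N ⊴ M → N →SF N' → Σ SF λ M' → (M →SF M') × (N' ⊴ M')
⊴-step self      s = _ , s , self
⊴-step (inL B p) s with ⊴-step p s
... | M' , s' , p' = M' · B , appL B s' , inL B p'
⊴-step (inR A p) s with ⊴-step p s
... | M' , s' , p' = A · M' , appR A s' , inR A p'

_≺_ : SF → SF → Set
N ≺ M = (M →SF N) ⊎ (N ◁ M)

-- On strongly normalising terms ≺ is well-founded: every subterm-or-self of
-- an SN term is ≺-accessible, by induction on the SN of the whole term.
SN-≺-accessible : ∀ M → SN-SF M → Acc _≺_ M
SN-≺-accessible M sn = below M sn M self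
  where
  below : ∀ M → SN-SF M → ∀ N → N ⊴ M → Acc _≺_ N
  step  : ∀ M → SN-SF M → ∀ N → N ⊴ M → ∀ {N'} → N' ≺ N → Acc _≺_ N'
  below M sn N p = acc (step M sn N p)
  step M (acc sn) N p (inj₁ s) with ⊴-step p s
  ... | M' , s' , p' = below M' (sn s') _ p'
  step M sn (A · B) p (inj₂ (subL _ _))  = below M sn A (⊴-trans (inL B self) p)
  step M sn (A · B) p (inj₂ (subR _ _))  = below M sn B (⊴-trans (inR A self) p)
  step M sn (A · B) p (inj₂ (deepL _ q)) = acc-inverse (below M sn A (⊴-trans (inL B self) p)) (inj₂ q)
  step M sn (A · B) p (inj₂ (deepR _ q)) = acc-inverse (below M sn B (⊴-trans (inR A self) p)) (inj₂ q)

-- Preservation of strong normalisation: ground terms in evaluation stacks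

data Value : Set
data Ground : Set

data Value where
  S0ᵛ F0ᵛ : Value
  S1ᵛ F1ᵛ : Ground → Value
  S2ᵛ F2ᵛ : Ground → Ground → Value

data Ground where
  val   : Value → Ground
  appᵍ  : Ground → Ground → Ground
  fredᵍ : Ground → Ground → Ground → Ground

toRT : Ground → RT
toRT (val S0ᵛ)       = S0
toRT (val F0ᵛ)       = F0
toRT (val (S1ᵛ a))   = S1 (toRT a)
toRT (val (F1ᵛ a))   = F1 (toRT a)
toRT (val (S2ᵛ a b)) = S2 (toRT a) (toRT b)
toRT (val (F2ᵛ a b)) = F2 (toRT a) (toRT b)
toRT (appᵍ a b)      = app (toRT a) (toRT b)
toRT (fredᵍ a b c)   = fred (toRT a) (toRT b) (toRT c)

⟦_⟧ᵍ : Ground → Λ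
⟦ e ⟧ᵍ = ⟦ toRT e ⟧ᵒ

decurry : Ground → SF
decurry (val S0ᵛ)       = S
decurry (val F0ᵛ)       = F
decurry (val (S1ᵛ a))   = S · decurry a
decurry (val (F1ᵛ a))   = F · decurry a
decurry (val (S2ᵛ a b)) = S · decurry a · decurry b
decurry (val (F2ᵛ a b)) = F · decurry a · decurry b
decurry (appᵍ a b)      = decurry a · decurry b
decurry (fredᵍ a b c)   = F · decurry a · decurry b · decurry c

curry : SF → Ground
curry S       = val S0ᵛ
curry F       = val F0ᵛ
curry (M · N) = appᵍ (curry M) (curry N)

toRT-curry : ∀ M → toRT (curry M) ≡ ⟦ M ⟧ₐ
toRT-curry S       = refl
toRT-curry F       = refl
toRT-curry (M · N) = cong₂ app (toRT-curry M) (toRT-curry N)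

decurry-curry : ∀ M → decurry (curry M) ≡ M
decurry-curry S       = refl
decurry-curry F       = refl
decurry-curry (M · N) = cong₂ _·_ (decurry-curry M) (decurry-curry N)

-- number of app-nodes; the rules app(c(x̄), y) → c'(x̄, y) and
-- app(F₂(x, y), z) → fred(x, y, z) decrease it
appNodes : Ground → ℕ
appNodes (val S0ᵛ)       = 0
appNodes (val F0ᵛ)       = 0
appNodes (val (S1ᵛ a))   = appNodes a
appNodes (val (F1ᵛ a))   = appNodes a
appNodes (val (S2ᵛ a b)) = appNodes a + appNodes b
appNodes (val (F2ᵛ a b)) = appNodes a + appNodes b
appNodes (appᵍ a b)      = suc (appNodes a + appNodes b)
appNodes (fredᵍ a b c)   = appNodes a + appNodes b + appNodes c

-- Evaluation stacks app(□, b) and fred(□, m, n), innermost frame first.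
data Frame : Set where
  appFrame  : Ground → Frame
  fredFrame : Ground → Ground → Frame

-- plugging into a stack, on the SF side and on the λ side; on the λ side the
-- ζ's of the frames are already unfolded, so the hole is in head position
plugSF : List Frame → SF → SF
plugSF []                   X = X
plugSF (appFrame b ∷ K)     X = plugSF K (X · decurry b)
plugSF (fredFrame m n ∷ K)  X = plugSF K (F · X · decurry m · decurry n)

plugΛ : List Frame → Λ → Λ
plugΛ []                  t = t
plugΛ (appFrame b ∷ K)    t = plugΛ K (t ∙ Tapp ∙ Tfred ∙ ⟦ b ⟧ᵍ)
plugΛ (fredFrame m n ∷ K) t = plugΛ K (t ∙ Tfred ∙ Tapp ∙ ⟦ m ⟧ᵍ ∙ ⟦ n ⟧ᵍ)

plugCount : List Frame → ℕ → ℕ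
plugCount []                  k = k
plugCount (appFrame b ∷ K)    k = plugCount K (suc (k + appNodes b))
plugCount (fredFrame m n ∷ K) k = plugCount K (k + appNodes m + appNodes n)

plugSF-step : ∀ K {X Y} → X →SF Y → plugSF K X →SF plugSF K Y
plugSF-step []                  s = s
plugSF-step (appFrame b ∷ K)    s = plugSF-step K (appL _ s)
plugSF-step (fredFrame m n ∷ K) s = plugSF-step K (appL _ (appL _ (appR F s)))

plugCount-mono : ∀ K {k l} → k < l → plugCount K k < plugCount K l
plugCount-mono []                  h = h
plugCount-mono (appFrame b ∷ K)    h = plugCount-mono K (s≤s (+-monoˡ-< (appNodes b) h))
plugCount-mono (fredFrame m n ∷ K) h = plugCount-mono K (+-monoˡ-< (appNodes n) (+-monoˡ-< (appNodes m) h))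

inStack : ∀ K {N X} → N ◁ X → N ◁ plugSF K X
inStack []                  q = q
inStack (appFrame b ∷ K)    q = inStack K (deepL _ q)
inStack (fredFrame m n ∷ K) q = inStack K (deepL _ (deepL _ (deepR F q)))

last-◁ : ∀ K {X} A → A ◁ plugSF K (X · A)
last-◁ K A = inStack K (subR _ A)

penultimate-◁ : ∀ K {X} A B → A ◁ plugSF K (X · A · B)
penultimate-◁ K A B = inStack K (deepL B (subR _ A))

reflects-plug : ∀ {t t'} → SN-reflects t t' → ∀ K → SNβ (plugΛ K t') → SNβ (plugΛ K t)
reflects-plug h []                  = h []
reflects-plug h (appFrame b ∷ K)    =
  reflects-plug (reflects-∙ ⟦ b ⟧ᵍ (reflects-∙ Tfred (reflects-∙ Tapp h))) K
reflects-plug h (fredFrame m n ∷ K) =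
  reflects-plug (reflects-∙ ⟦ n ⟧ᵍ (reflects-∙ ⟦ m ⟧ᵍ (reflects-∙ Tapp (reflects-∙ Tfred h)))) K

-- The main lemma, for the ground term e in the stack K, by induction on
-- the ≺-accessibility of the SF-term it denotes, then on the number of
-- app-nodes, then on e.
StackSN : Ground → List Frame → Set
StackSN e K = Acc _≺_ (plugSF K (decurry e)) → Acc _<_ (plugCount K (appNodes e)) → SNβ (plugΛ K ⟦ e ⟧ᵍ)

stack-SN      : ∀ e K → StackSN e K
value-SN      : ∀ w → StackSN (val w) []
app-redex-SN  : ∀ w b K → StackSN (val w) (appFrame b ∷ K)
fred-redex-SN : ∀ w m n K → StackSN (val w) (fredFrame m n ∷ K)
-- subterms of the denoted SF-term are ≺-smaller, so their translations are SN
component-SN  : ∀ {M} → Acc _≺_ M → ∀ e → decurry e ◁ M → SNβ ⟦ e ⟧ᵍ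

stack-SN (appᵍ a b) K am ac =
  reflects-plug (ζapp-reflects ⟦ a ⟧ᵍ ⟦ b ⟧ᵍ) K (stack-SN a (appFrame b ∷ K) am ac)
stack-SN (fredᵍ a m n) K am ac =
  reflects-plug (ζfred-reflects ⟦ a ⟧ᵍ ⟦ m ⟧ᵍ ⟦ n ⟧ᵍ) K (stack-SN a (fredFrame m n ∷ K) am ac)
stack-SN (val w) []                  am ac = value-SN w am ac
stack-SN (val w) (appFrame b ∷ K)    am ac = app-redex-SN w b K am ac
stack-SN (val w) (fredFrame m n ∷ K) am ac = fred-redex-SN w m n K am ac

component-SN (acc rec) e q = stack-SN e [] (rec (inj₂ q)) (<-wellFounded _)

value-SN S0ᵛ _ _ = con-SN S₀ var var-SN
value-SN F0ᵛ _ _ = con-SN F₀ var var-SN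
value-SN (S1ᵛ a) am _ =
  con-SN S₁ (x ≔ ⟦ a ⟧ᵍ ⨾ var) (≔-SN x (component-SN am a (last-◁ [] _)) var-SN)
value-SN (F1ᵛ a) am _ =
  con-SN F₁ (x ≔ ⟦ a ⟧ᵍ ⨾ var) (≔-SN x (component-SN am a (last-◁ [] _)) var-SN)
value-SN (S2ᵛ a c) am _ =
  con-SN S₂ (x ≔ ⟦ a ⟧ᵍ ⨾ y ≔ ⟦ c ⟧ᵍ ⨾ var)
    (≔-SN x (component-SN am a (penultimate-◁ [] _ _)) (≔-SN y (component-SN am c (last-◁ [] _)) var-SN))
value-SN (F2ᵛ a c) am _ =
  con-SN F₂ (x ≔ ⟦ a ⟧ᵍ ⨾ y ≔ ⟦ c ⟧ᵍ ⨾ var)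
    (≔-SN x (component-SN am a (penultimate-◁ [] _ _)) (≔-SN y (component-SN am c (last-◁ [] _)) var-SN))

-- app(c(ā), b): the rule builds a larger value or a fred (fewer app-nodes),
-- or it is the S-rule (an SF-step)
app-redex-SN S0ᵛ b K am (acc rec) =
  let sb = component-SN am b (last-◁ K _)
  in reflects-plug (rule-reflects appP S₀ _ (≔-SN x sb var-SN)) K
       (stack-SN (val (S1ᵛ b)) K am (rec (plugCount-mono K (n<1+n _))))
app-redex-SN F0ᵛ b K am (acc rec) =
  let sb = component-SN am b (last-◁ K _)
  in reflects-plug (rule-reflects appP F₀ _ (≔-SN x sb var-SN)) K
       (stack-SN (val (F1ᵛ b)) K am (rec (plugCount-mono K (n<1+n _))))
app-redex-SN (S1ᵛ a) b K am (acc rec) =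
  let sa = component-SN am a (last-◁ (appFrame b ∷ K) _)
      sb = component-SN am b (last-◁ K _)
  in reflects-plug (rule-reflects appP S₁ _ (≔-SN x sa (≔-SN y sb var-SN))) K
       (stack-SN (val (S2ᵛ a b)) K am (rec (plugCount-mono K (n<1+n _))))
app-redex-SN (F1ᵛ a) b K am (acc rec) =
  let sa = component-SN am a (last-◁ (appFrame b ∷ K) _)
      sb = component-SN am b (last-◁ K _)
  in reflects-plug (rule-reflects appP F₁ _ (≔-SN x sa (≔-SN y sb var-SN))) K
       (stack-SN (val (F2ᵛ a b)) K am (rec (plugCount-mono K (n<1+n _))))
app-redex-SN (S2ᵛ a c) b K (acc rec) _ =
  let sa = component-SN (acc rec) a (penultimate-◁ (appFrame b ∷ K) _ _)
      sc = component-SN (acc rec) c (last-◁ (appFrame b ∷ K) _)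
      sb = component-SN (acc rec) b (last-◁ K _)
  in reflects-plug (rule-reflects appP S₂ _ (≔-SN x sa (≔-SN y sc (≔-SN z sb var-SN)))) K
       (stack-SN (appᵍ (appᵍ a b) (appᵍ c b)) K (rec (inj₁ (plugSF-step K (sRule _ _ _)))) (<-wellFounded _))
app-redex-SN (F2ᵛ a c) b K am (acc rec) =
  let sa = component-SN am a (penultimate-◁ (appFrame b ∷ K) _ _)
      sc = component-SN am c (last-◁ (appFrame b ∷ K) _)
      sb = component-SN am b (last-◁ K _)
  in reflects-plug (rule-reflects appP F₂ _ (≔-SN x sa (≔-SN y sc (≔-SN z sb var-SN)))) K
       (stack-SN (fredᵍ a c b) K am (rec (plugCount-mono K (n<1+n _))))

-- fred(c(ā), m, n): every rule is an F-rule of SF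
fred-redex-SN S0ᵛ m n K (acc rec) _ =
  let sm = component-SN (acc rec) m (penultimate-◁ K _ _)
      sn = component-SN (acc rec) n (last-◁ K _)
  in reflects-plug (rule-reflects fredP S₀ _ (≔-SN y sm (≔-SN z sn var-SN))) K
       (stack-SN m K (rec (inj₁ (plugSF-step K (fAtom _ _ _ aS)))) (<-wellFounded _))
fred-redex-SN F0ᵛ m n K (acc rec) _ =
  let sm = component-SN (acc rec) m (penultimate-◁ K _ _)
      sn = component-SN (acc rec) n (last-◁ K _)
  in reflects-plug (rule-reflects fredP F₀ _ (≔-SN y sm (≔-SN z sn var-SN))) K
       (stack-SN m K (rec (inj₁ (plugSF-step K (fAtom _ _ _ aF)))) (<-wellFounded _))
fred-redex-SN (S1ᵛ a) m n K (acc rec) _ =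
  let sa = component-SN (acc rec) a (last-◁ (fredFrame m n ∷ K) _)
      sm = component-SN (acc rec) m (penultimate-◁ K _ _)
      sn = component-SN (acc rec) n (last-◁ K _)
  in reflects-plug (rule-reflects fredP S₁ _ (≔-SN x sa (≔-SN y sm (≔-SN z sn var-SN)))) K
       (stack-SN (appᵍ (appᵍ n (val S0ᵛ)) a) K (rec (inj₁ (plugSF-step K (fComp _ _ _ _ (fS1 _))))) (<-wellFounded _))
fred-redex-SN (F1ᵛ a) m n K (acc rec) _ =
  let sa = component-SN (acc rec) a (last-◁ (fredFrame m n ∷ K) _)
      sm = component-SN (acc rec) m (penultimate-◁ K _ _)
      sn = component-SN (acc rec) n (last-◁ K _)
  in reflects-plug (rule-reflects fredP F₁ _ (≔-SN x sa (≔-SN y sm (≔-SN z sn var-SN)))) K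
       (stack-SN (appᵍ (appᵍ n (val F0ᵛ)) a) K (rec (inj₁ (plugSF-step K (fComp _ _ _ _ (fF1 _))))) (<-wellFounded _))
fred-redex-SN (S2ᵛ a c) m n K (acc rec) _ =
  let sa = component-SN (acc rec) a (penultimate-◁ (fredFrame m n ∷ K) _ _)
      sc = component-SN (acc rec) c (last-◁ (fredFrame m n ∷ K) _)
      sm = component-SN (acc rec) m (penultimate-◁ K _ _)
      sn = component-SN (acc rec) n (last-◁ K _)
  in reflects-plug (rule-reflects fredP S₂ _ (≔-SN p sa (≔-SN q sc (≔-SN y sm (≔-SN z sn var-SN))))) K
       (stack-SN (appᵍ (appᵍ n (appᵍ (val S0ᵛ) a)) c) K
         (rec (inj₁ (plugSF-step K (fComp _ _ _ _ (fS2 _ _))))) (<-wellFounded _))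
fred-redex-SN (F2ᵛ a c) m n K (acc rec) _ =
  let sa = component-SN (acc rec) a (penultimate-◁ (fredFrame m n ∷ K) _ _)
      sc = component-SN (acc rec) c (last-◁ (fredFrame m n ∷ K) _)
      sm = component-SN (acc rec) m (penultimate-◁ K _ _)
      sn = component-SN (acc rec) n (last-◁ K _)
  in reflects-plug (rule-reflects fredP F₂ _ (≔-SN p sa (≔-SN q sc (≔-SN y sm (≔-SN z sn var-SN))))) K
       (stack-SN (appᵍ (appᵍ n (appᵍ (val F0ᵛ) a)) c) K
         (rec (inj₁ (plugSF-step K (fComp _ _ _ _ (fF2 _ _))))) (<-wellFounded _))

-- ⟦ M ⟧λ is the translation of the ground term curry M in the empty stack
normalisation : ∀ M → SN-SF M → SNβ ⟦ M ⟧λ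
normalisation M sn =
  transport SNβ (cong ⟦_⟧ᵒ (toRT-curry M))
    (stack-SN (curry M) [] (transport (Acc _≺_) (sym (decurry-curry M)) (SN-≺-accessible M sn)) (<-wellFounded _))

mainTheorem5 : (∀ M N → M →SF* N → ⟦ M ⟧λ →β* ⟦ N ⟧λ)
                 × (∀ M → SN-SF M → SNβ ⟦ M ⟧λ)
mainTheorem5 = (λ _ _ → simulate) , normalisation
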